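{- Let $S=\{s_n\}_{n\ge1}$ and $T=\{t_n\}_{n\ge1}$ be increasing sequences (finite or infinite) of positive odd integers, and let $W=\{w_n\}_{n\ge1}=S\cap T$ be the increasing sequence of their common terms. For real $y$ let $S(y)=\#\{n: s_n\le y\}$, $T(y)=\#\{n: t_n\le y\}$, $W(y)=\#\{n: w_n\le y\}$ be the counting functions. For a positive even integer $x$, let $g(x)$ be the number of solutions of $x=s+t$ with $s\in S$, $t\in T$, where the order of the summands is not important; that is, $g(x)$ is the number of pairs $(a,b)$ of integers with $a\le b$, $a+b=x$, such that ($a\in S$ and $b\in T$) or ($a\in T$ and $b\in S$). Then for every even $x\ge4$, $$g(x)=\sum_{t\in T,\ t\le x/2}S(x-t)+\sum_{s\in S,\ s\le x/2}T(x-s)-\sum_{w\in W,\ w\le x/2}W(x-w)-S(x/2)\,T(x/2)+\binom{W(x/2)+1}{2}-g(x-2)-g(x-4)-\dots-g(2).$$ -}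

module Defs where

open import Data.Nat using (ℕ; zero; suc; _+_; _*_; _∸_; _≤_; _≤?_)
open import Data.Product using (Σ; _×_)
open import Data.Sum using (_⊎_)
open import Data.Bool using (if_then_else_)
open import Relation.Nullary using (does)
open import Relation.Nullary.Decidable using (_×-dec_; _⊎-dec_)
open import Relation.Unary using (Pred; Decidable; _∩_)
open import Relation.Binary.PropositionalEquality using (_≡_)
open import Level using (0ℓ)

Odd : ℕ → Set
Odd n = Σ ℕ λ k → n ≡ suc (2 * k)

-- A (finite or infinite) increasing sequence of positive integers is
-- identified with its set of terms, given as a decidable predicate on ℕ.

[_] : ∀ {P : Set} → Relation.Nullary.Dec P → ℕ
[ d ] = if does d then 1 else 0

count : {A : Pred ℕ 0ℓ} → Decidable A → ℕ → ℕ
count d zero    = 0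
count d (suc y) = [ d (suc y) ] + count d y

sumOver : {A : Pred ℕ 0ℓ} → Decidable A → (ℕ → ℕ) → ℕ → ℕ
sumOver d h zero    = 0
sumOver d h (suc m) = [ d (suc m) ] * h (suc m) + sumOver d h m

-- g(x) = #{ (a , b) : 0 ≤ a ≤ b , a + b = x ,
--                     (a ∈ S and b ∈ T) or (a ∈ T and b ∈ S) }
-- (a ranges over 0..x with b = x ∸ a; negative a are impossible since
--  S, T consist of positive integers)
gAux : {S T : Pred ℕ 0ℓ} → Decidable S → Decidable T → ℕ → ℕ → ℕ
gAux dS dT x zero    = [ (0 + 0 ≤? x) ×-dec ((dS 0 ×-dec dT x) ⊎-dec (dT 0 ×-dec dS x)) ]
gAux dS dT x (suc a) =
  [ (suc a + suc a ≤? x) ×-dec ((dS (suc a) ×-dec dT (x ∸ suc a)) ⊎-dec (dT (suc a) ×-dec dS (x ∸ suc a))) ]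
  + gAux dS dT x a

g : {S T : Pred ℕ 0ℓ} → Decidable S → Decidable T → ℕ → ℕ
g dS dT x = gAux dS dT x x

gSum : {S T : Pred ℕ 0ℓ} → Decidable S → Decidable T → ℕ → ℕ
gSum dS dT zero    = 0
gSum dS dT (suc k) = g dS dT (2 * suc k) + gSum dS dT k

∩-dec : {S T : Pred ℕ 0ℓ} → Decidable S → Decidable T → Decidable (S ∩ T)
∩-dec dS dT n = dS n ×-dec dT n

{-# OPTIONS --safe #-}
-- Put h = x/2 and count pairs (a, b) of positive integers with 0/1 weights. As S and T
-- consist of odd numbers, g vanishes at odd arguments, so g(x) + g(x-2) + ... + g(2) is the
-- number of pairs in S×T ∪ T×S with a ≤ b and a + b ≤ x. The first two sums of the formula
-- count the pairs of T×S and of S×T in the strip a ≤ h, a + b ≤ x; by inclusion-exclusion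
-- (the two products meet in W×W) their total is the third sum plus the number of pairs of
-- S×T ∪ T×S in the strip. The strip is the disjoint union of the pairs with a ≤ b, a + b ≤ x
-- and the pairs with b < a ≤ h. Finally S(h)T(h) counts S×T on the square [1, h]², which
-- splits into the part below the diagonal, the part above it (a copy of T×S below it) and
-- the diagonal (a copy of W); by inclusion-exclusion again this is the number of pairs
-- b < a ≤ h in S×T ∪ T×S plus the number of pairs b ≤ a ≤ h in W×W, i.e. C(W(h)+1, 2).
module Submission where

open import Defs

module Counting where
  open import Data.Bool using (Bool; true; false; _∧_; _∨_; if_then_else_)
  open import Data.Nat
  open import Data.Nat.Properties
  open import Algebra.Properties.CommutativeSemigroup +-commutativeSemigroup
    using () renaming (interchange to +-interchange)
  open import Algebra.Properties.CommutativeSemigroup *-commutativeSemigroup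
    using () renaming (interchange to *-interchange)
  open import Data.Nat.Tactic.RingSolver using (solve-∀)
  open import Data.Nat.Combinatorics using (_C_; nC1≡n; nCk+nC[k+1]≡[n+1]C[k+1])
  open import Data.Product using (_×_; _,_; proj₂; map₁)
  open import Data.Sum using (_⊎_; inj₁; inj₂) renaming ([_,_] to either)
  import Data.Sum as Sum
  open import Function using (_∘_; id)
  open import Relation.Nullary using (Dec; yes; no; does; ¬_; contradiction)
  open import Relation.Nullary.Decidable using (_×-dec_; _⊎-dec_)
  open import Relation.Unary using (Pred; Decidable; _∩_)
  open import Relation.Binary.Definitions using (tri<; tri≈; tri>)
  open import Relation.Binary.PropositionalEquality hiding ([_])
  open import Level using (0ℓ)
  open ≡-Reasoning

  ∑ : ℕ → (ℕ → ℕ) → ℕ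
  ∑ zero    f = 0
  ∑ (suc n) f = f (suc n) + ∑ n f

  ∑-cong : ∀ n {f g : ℕ → ℕ} → (∀ i → 1 ≤ i → i ≤ n → f i ≡ g i) → ∑ n f ≡ ∑ n g
  ∑-cong zero    eq = refl
  ∑-cong (suc n) eq =
    cong₂ _+_ (eq (suc n) (s≤s z≤n) ≤-refl) (∑-cong n λ i 1≤i i≤n → eq i 1≤i (m≤n⇒m≤1+n i≤n))

  ∑-zero : ∀ n {f : ℕ → ℕ} → (∀ i → i ≤ n → f i ≡ 0) → ∑ n f ≡ 0
  ∑-zero zero    _  = refl
  ∑-zero (suc n) f0 = cong₂ _+_ (f0 (suc n) ≤-refl) (∑-zero n λ i i≤n → f0 i (m≤n⇒m≤1+n i≤n))

  ∑-+ : ∀ n (f g : ℕ → ℕ) → ∑ n (λ i → f i + g i) ≡ ∑ n f + ∑ n g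
  ∑-+ zero    f g = refl
  ∑-+ (suc n) f g = trans (cong (f (suc n) + g (suc n) +_) (∑-+ n f g))
                          (+-interchange (f (suc n)) (g (suc n)) (∑ n f) (∑ n g))

  ∑-*ˡ : ∀ n c (f : ℕ → ℕ) → c * ∑ n f ≡ ∑ n (λ i → c * f i)
  ∑-*ˡ zero    c f = *-zeroʳ c
  ∑-*ˡ (suc n) c f = trans (*-distribˡ-+ c (f (suc n)) (∑ n f)) (cong (c * f (suc n) +_) (∑-*ˡ n c f))

  ∑-comm : ∀ m n (F : ℕ → ℕ → ℕ) → ∑ m (λ i → ∑ n (F i)) ≡ ∑ n (λ j → ∑ m (λ i → F i j))
  ∑-comm zero    n F = sym (∑-zero n λ _ _ → refl)
  ∑-comm (suc m) n F = trans (cong (∑ n (F (suc m)) +_) (∑-comm m n F)) (sym (∑-+ n (F (suc m)) _))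

  []≡1 : ∀ {P : Set} (p : Dec P) → P → [ p ] ≡ 1
  []≡1 (yes _) _  = refl
  []≡1 (no ¬p) p = contradiction p ¬p

  []≡0 : ∀ {P : Set} (p : Dec P) → ¬ P → [ p ] ≡ 0
  []≡0 (yes p) ¬p = contradiction p ¬p
  []≡0 (no _)  _  = refl

  []-× : ∀ {P Q : Set} (p : Dec P) (q : Dec Q) → [ p ×-dec q ] ≡ [ p ] * [ q ]
  []-× (yes _) (yes _) = refl
  []-× (yes _) (no _)  = refl
  []-× (no _)  _       = refl

  []-⇔ : ∀ {P Q : Set} (p : Dec P) (q : Dec Q) → (P → Q) → (Q → P) → [ p ] ≡ [ q ]
  []-⇔ p (yes q) _   Q⇒P = []≡1 p (Q⇒P q)
  []-⇔ p (no ¬q) P⇒Q _   = []≡0 p (¬q ∘ P⇒Q)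

  []-⊎ : ∀ {P Q R : Set} (p : Dec P) (q : Dec Q) (r : Dec R) →
         (P → Q ⊎ R) → (Q ⊎ R → P) → (Q → ¬ R) → [ p ] ≡ [ q ] + [ r ]
  []-⊎ p (yes q) (yes r) _   _   disj = contradiction r (disj q)
  []-⊎ p (yes q) (no _)  _   Q⊎R⇒P _  = []≡1 p (Q⊎R⇒P (inj₁ q))
  []-⊎ p (no _)  (yes r) _   Q⊎R⇒P _  = []≡1 p (Q⊎R⇒P (inj₂ r))
  []-⊎ p (no ¬q) (no ¬r) P⇒Q⊎R _ _  = []≡0 p (either ¬q ¬r ∘ P⇒Q⊎R)

  []-*-cong : ∀ {P : Set} (p : Dec P) {m n : ℕ} → (P → m ≡ n) → [ p ] * m ≡ [ p ] * n
  []-*-cong (yes p) eq = cong (1 *_) (eq p)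
  []-*-cong (no _)  _  = refl

  [q]*[p×r]≡[p×q]*[r] : ∀ {P Q R : Set} (p : Dec P) (q : Dec Q) (r : Dec R) →
                         [ q ] * [ p ×-dec r ] ≡ [ p ×-dec q ] * [ r ]
  [q]*[p×r]≡[p×q]*[r] p q r = begin
      [ q ] * [ p ×-dec r ]   ≡⟨ cong ([ q ] *_) ([]-× p r) ⟩
      [ q ] * ([ p ] * [ r ]) ≡⟨ *-assoc [ q ] [ p ] [ r ] ⟨
      [ q ] * [ p ] * [ r ]   ≡⟨ cong (_* [ r ]) (*-comm [ q ] [ p ]) ⟩
      [ p ] * [ q ] * [ r ]   ≡⟨ cong (_* [ r ]) ([]-× p q) ⟨
      [ p ×-dec q ] * [ r ]   ∎

  𝟙 : Bool → ℕ
  𝟙 b = if b then 1 else 0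

  𝟙-inclusion-exclusion : ∀ p q r s →
    𝟙 ((p ∧ q) ∨ (r ∧ s)) + 𝟙 (p ∧ r) * 𝟙 (s ∧ q) ≡ 𝟙 p * 𝟙 q + 𝟙 r * 𝟙 s
  𝟙-inclusion-exclusion true  true  true  true  = refl
  𝟙-inclusion-exclusion true  true  true  false = refl
  𝟙-inclusion-exclusion true  true  false true  = refl
  𝟙-inclusion-exclusion true  true  false false = refl
  𝟙-inclusion-exclusion true  false true  true  = refl
  𝟙-inclusion-exclusion true  false true  false = refl
  𝟙-inclusion-exclusion true  false false true  = refl
  𝟙-inclusion-exclusion true  false false false = refl
  𝟙-inclusion-exclusion false true  true  true  = refl
  𝟙-inclusion-exclusion false true  true  false = refl
  𝟙-inclusion-exclusion false true  false true  = refl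
  𝟙-inclusion-exclusion false true  false false = refl
  𝟙-inclusion-exclusion false false true  true  = refl
  𝟙-inclusion-exclusion false false true  false = refl
  𝟙-inclusion-exclusion false false false true  = refl
  𝟙-inclusion-exclusion false false false false = refl

  𝟙-∧-idem : ∀ p r → 𝟙 p * 𝟙 r ≡ 𝟙 (p ∧ r) * 𝟙 (p ∧ r)
  𝟙-∧-idem true  true  = refl
  𝟙-∧-idem true  false = refl
  𝟙-∧-idem false _     = refl

  ∑-truncate : ∀ {m n} (f : ℕ → ℕ) → m ≤ n → ∑ m f ≡ ∑ n (λ i → [ i ≤? m ] * f i)
  ∑-truncate {m} f m≤n = go (≤⇒≤′ m≤n)
    where
    go : ∀ {n} → m ≤′ n → ∑ m f ≡ ∑ n (λ i → [ i ≤? m ] * f i)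
    go ≤′-refl = ∑-cong m λ i _ i≤m → sym (trans (cong (_* f i) ([]≡1 (i ≤? m) i≤m)) (*-identityˡ (f i)))
    go (≤′-step {n} m≤′n) = trans (go m≤′n) (cong (_+ ∑ n (λ i → [ i ≤? m ] * f i)) (sym top≡0))
      where
      top≡0 : [ suc n ≤? m ] * f (suc n) ≡ 0
      top≡0 = cong (_* f (suc n)) ([]≡0 (suc n ≤? m) (<⇒≱ (s≤s (≤′⇒≤ m≤′n))))

  ∑-shift : ∀ m a (f : ℕ → ℕ) → ∑ (m + a) (λ y → [ a <? y ] * f (y ∸ a)) ≡ ∑ m f
  ∑-shift zero    a f = ∑-zero a λ y y≤a → cong (_* f (y ∸ a)) ([]≡0 (a <? y) (≤⇒≯ y≤a))
  ∑-shift (suc m) a f = cong₂ _+_ top (∑-shift m a f)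
    where
    top : [ a <? suc (m + a) ] * f (suc (m + a) ∸ a) ≡ f (suc m)
    top = begin
        [ a <? suc (m + a) ] * f (suc (m + a) ∸ a)
      ≡⟨ cong (_* f (suc (m + a) ∸ a)) ([]≡1 (a <? suc (m + a)) (s≤s (m≤n+m a m))) ⟩
        1 * f (suc m + a ∸ a)
      ≡⟨ *-identityˡ _ ⟩
        f (suc m + a ∸ a)
      ≡⟨ cong f (m+n∸n≡m (suc m) a) ⟩
        f (suc m)
      ∎

  ∑-evens : ∀ k (f : ℕ → ℕ) → (∀ i → f (suc (2 * i)) ≡ 0) → ∑ (2 * k) f ≡ ∑ k (λ i → f (2 * i))
  ∑-evens zero    f odd0 = refl
  ∑-evens (suc k) f odd0 = begin
      ∑ (2 * suc k) f
    ≡⟨ cong (λ n → ∑ n f) (*-suc 2 k) ⟩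
      f (2 + 2 * k) + (f (suc (2 * k)) + ∑ (2 * k) f)
    ≡⟨ cong₂ (λ u v → f (2 + 2 * k) + (u + v)) (odd0 k) (∑-evens k f odd0) ⟩
      f (2 + 2 * k) + ∑ k (λ i → f (2 * i))
    ≡⟨ cong (λ n → f n + ∑ k (λ i → f (2 * i))) (sym (*-suc 2 k)) ⟩
      ∑ (suc k) (λ i → f (2 * i))
    ∎

  count≡∑ : ∀ {A : Pred ℕ 0ℓ} (d : Decidable A) y → count d y ≡ ∑ y (λ b → [ d b ])
  count≡∑ d zero    = refl
  count≡∑ d (suc y) = cong ([ d (suc y) ] +_) (count≡∑ d y)

  sumOver≡∑ : ∀ {A : Pred ℕ 0ℓ} (d : Decidable A) (f : ℕ → ℕ) m →
              sumOver d f m ≡ ∑ m (λ a → [ d a ] * f a)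
  sumOver≡∑ d f zero    = refl
  sumOver≡∑ d f (suc m) = cong ([ d (suc m) ] * f (suc m) +_) (sumOver≡∑ d f m)

  count*≡sumOver : ∀ {A : Pred ℕ 0ℓ} (d : Decidable A) m c → count d m * c ≡ sumOver d (λ _ → c) m
  count*≡sumOver d zero    c = refl
  count*≡sumOver d (suc m) c =
    trans (*-distribʳ-+ c [ d (suc m) ] (count d m)) (cong ([ d (suc m) ] * c +_) (count*≡sumOver d m c))

  choose-2-step : ∀ {P : Set} (p : Dec P) c → ([ p ] + c + 1) C 2 ≡ [ p ] * ([ p ] + c) + (c + 1) C 2
  choose-2-step (yes _) c = begin
      (suc c + 1) C 2
    ≡⟨ nCk+nC[k+1]≡[n+1]C[k+1] (c + 1) 1 ⟨
      (c + 1) C 1 + (c + 1) C 2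
    ≡⟨ cong (_+ (c + 1) C 2) (trans (nC1≡n (c + 1)) (+-comm c 1)) ⟩
      suc c + (c + 1) C 2
    ≡⟨ cong (_+ (c + 1) C 2) (*-identityˡ (suc c)) ⟨
      1 * suc c + (c + 1) C 2
    ∎
  choose-2-step (no _)  c = refl

  count-choose-2 : ∀ {A : Pred ℕ 0ℓ} (d : Decidable A) m → (count d m + 1) C 2 ≡ sumOver d (count d) m
  count-choose-2 d zero    = refl
  count-choose-2 d (suc m) =
    trans (choose-2-step (d (suc m)) (count d m)) (cong ([ d (suc m) ] * count d (suc m) +_) (count-choose-2 d m))

  _⊗_ : ∀ {A B : Pred ℕ 0ℓ} → Decidable A → Decidable B → ℕ → ℕ → ℕ
  (dA ⊗ dB) a b = [ dA a ] * [ dB b ]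

  ∑∑ : ℕ → (ℕ → ℕ → ℕ) → ℕ
  ∑∑ n F = ∑ n (λ a → ∑ n (F a))

  sumOver-count≡∑∑ : ∀ {A B : Pred ℕ 0ℓ} (dA : Decidable A) (dB : Decidable B) (φ : ℕ → ℕ) {m n} →
                     m ≤ n → (∀ a → a ≤ m → φ a ≤ n) →
                     sumOver dA (λ a → count dB (φ a)) m
                     ≡ ∑∑ n (λ a b → [ a ≤? m ×-dec b ≤? φ a ] * (dA ⊗ dB) a b)
  sumOver-count≡∑∑ dA dB φ {m} {n} m≤n φ≤n = begin
      sumOver dA (λ a → count dB (φ a)) m
    ≡⟨ sumOver≡∑ dA (λ a → count dB (φ a)) m ⟩
      ∑ m (λ a → [ dA a ] * count dB (φ a))
    ≡⟨ ∑-truncate (λ a → [ dA a ] * count dB (φ a)) m≤n ⟩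
      ∑ n (λ a → [ a ≤? m ] * ([ dA a ] * count dB (φ a)))
    ≡⟨ ∑-cong n (λ a _ _ → row a) ⟩
      ∑∑ n (λ a b → [ a ≤? m ×-dec b ≤? φ a ] * (dA ⊗ dB) a b)
    ∎
    where
    row : ∀ a → [ a ≤? m ] * ([ dA a ] * count dB (φ a))
                ≡ ∑ n (λ b → [ a ≤? m ×-dec b ≤? φ a ] * (dA ⊗ dB) a b)
    row a = begin
        [ a ≤? m ] * ([ dA a ] * count dB (φ a))
      ≡⟨ []-*-cong (a ≤? m) (λ a≤m → cong ([ dA a ] *_)
           (trans (count≡∑ dB (φ a)) (∑-truncate (λ b → [ dB b ]) (φ≤n a a≤m)))) ⟩
        [ a ≤? m ] * ([ dA a ] * ∑ n (λ b → [ b ≤? φ a ] * [ dB b ]))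
      ≡⟨ *-assoc [ a ≤? m ] [ dA a ] _ ⟨
        [ a ≤? m ] * [ dA a ] * ∑ n (λ b → [ b ≤? φ a ] * [ dB b ])
      ≡⟨ ∑-*ˡ n ([ a ≤? m ] * [ dA a ]) (λ b → [ b ≤? φ a ] * [ dB b ]) ⟩
        ∑ n (λ b → [ a ≤? m ] * [ dA a ] * ([ b ≤? φ a ] * [ dB b ]))
      ≡⟨ ∑-cong n (λ b _ _ → trans (*-interchange [ a ≤? m ] [ dA a ] [ b ≤? φ a ] [ dB b ])
                                   (cong (_* (dA ⊗ dB) a b) (sym ([]-× (a ≤? m) (b ≤? φ a))))) ⟩
        ∑ n (λ b → [ a ≤? m ×-dec b ≤? φ a ] * (dA ⊗ dB) a b)
      ∎

  ∑∑-cong : ∀ n {F G : ℕ → ℕ → ℕ} → (∀ a b → F a b ≡ G a b) → ∑∑ n F ≡ ∑∑ n G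
  ∑∑-cong n eq = ∑-cong n (λ a _ _ → ∑-cong n (λ b _ _ → eq a b))

  ∑∑-+ : ∀ n (F G : ℕ → ℕ → ℕ) → ∑∑ n (λ a b → F a b + G a b) ≡ ∑∑ n F + ∑∑ n G
  ∑∑-+ n F G = trans (∑-cong n (λ a _ _ → ∑-+ n (F a) (G a))) (∑-+ n _ _)

  module RegionSums (n : ℕ) where

    ⟪_∣_⟫ : {R : ℕ → ℕ → Set} → (∀ a b → Dec (R a b)) → (ℕ → ℕ → ℕ) → ℕ
    ⟪ R? ∣ F ⟫ = ∑∑ n (λ a b → [ R? a b ] * F a b)

    ⟪⟫-split-weight : ∀ {R : ℕ → ℕ → Set} (R? : ∀ a b → Dec (R a b)) {F G H : ℕ → ℕ → ℕ} →
                      (∀ a b → F a b ≡ G a b + H a b) → ⟪ R? ∣ F ⟫ ≡ ⟪ R? ∣ G ⟫ + ⟪ R? ∣ H ⟫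
    ⟪⟫-split-weight R? {F} {G} {H} eq = trans
      (∑∑-cong n λ a b → trans (cong ([ R? a b ] *_) (eq a b)) (*-distribˡ-+ [ R? a b ] (G a b) (H a b)))
      (∑∑-+ n _ _)

    ⟪⟫-split-region : ∀ {R R₁ R₂ : ℕ → ℕ → Set}
                      (R? : ∀ a b → Dec (R a b)) (R₁? : ∀ a b → Dec (R₁ a b)) (R₂? : ∀ a b → Dec (R₂ a b)) →
                      (∀ a b → [ R? a b ] ≡ [ R₁? a b ] + [ R₂? a b ]) →
                      ∀ F → ⟪ R? ∣ F ⟫ ≡ ⟪ R₁? ∣ F ⟫ + ⟪ R₂? ∣ F ⟫
    ⟪⟫-split-region R? R₁? R₂? eq F = trans
      (∑∑-cong n λ a b → trans (cong (_* F a b) (eq a b)) (*-distribʳ-+ (F a b) [ R₁? a b ] [ R₂? a b ]))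
      (∑∑-+ n _ _)

    ⟪⟫-transpose : ∀ {R : ℕ → ℕ → Set} (R? : ∀ a b → Dec (R a b)) F →
                   ⟪ (λ a b → R? b a) ∣ F ⟫ ≡ ⟪ R? ∣ (λ a b → F b a) ⟫
    ⟪⟫-transpose R? F = ∑-comm n n (λ a b → [ R? b a ] * F a b)

  [a≤y]*[a+a≤y]≡[a<y]*[a≤y∸a] : ∀ {a y} {R : Set} (r : Dec R) → 1 ≤ a →
    [ a ≤? y ] * [ (a + a ≤? y) ×-dec r ] ≡ [ a <? y ] * [ a ≤? y ∸ a ×-dec r ]
  [a≤y]*[a+a≤y]≡[a<y]*[a≤y∸a] {a} {y} {R} r 1≤a = by-cases (a <? y)
    where
    by-cases : (a<?y : Dec (a < y)) → [ a ≤? y ] * [ (a + a ≤? y) ×-dec r ] ≡ [ a<?y ] * [ a ≤? y ∸ a ×-dec r ]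
    by-cases (yes a<y) = begin
        [ a ≤? y ] * [ (a + a ≤? y) ×-dec r ]
      ≡⟨ cong (_* [ (a + a ≤? y) ×-dec r ]) ([]≡1 (a ≤? y) (<⇒≤ a<y)) ⟩
        1 * [ (a + a ≤? y) ×-dec r ]
      ≡⟨ cong (1 *_) ([]-⇔ ((a + a ≤? y) ×-dec r) (a ≤? y ∸ a ×-dec r)
                            (map₁ (m+n≤o⇒m≤o∸n a)) (map₁ (m≤o∸n⇒m+n≤o a (<⇒≤ a<y)))) ⟩
        1 * [ a ≤? y ∸ a ×-dec r ]
      ∎
    by-cases (no a≮y) = trans (cong ([ a ≤? y ] *_) ([]≡0 ((a + a ≤? y) ×-dec r) a+a≰y)) (*-zeroʳ [ a ≤? y ])
      where
      a+a≰y : ¬ (a + a ≤ y × R)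
      a+a≰y (a+a≤y , _) = a≮y (<-≤-trans (m<m+n a 1≤a) a+a≤y)

  m+m≤n+n⇒m≤n : ∀ {m n} → m + m ≤ n + n → m ≤ n
  m+m≤n+n⇒m≤n m+m≤n+n = ≮⇒≥ (λ n<m → <⇒≱ (+-mono-< n<m n<m) m+m≤n+n)

  ¬Odd0 : ¬ Odd 0
  ¬Odd0 (_ , ())

  odd+odd-not-odd : ∀ {a b} → Odd a → Odd b → ¬ Odd (a + b)
  odd+odd-not-odd (i , refl) (j , refl) (k , a+b≡1+2k) =
    even≢odd (suc (i + j)) k (trans (sym (odd+odd i j)) a+b≡1+2k)
    where
    odd+odd : ∀ i j → suc (2 * i) + suc (2 * j) ≡ 2 * suc (i + j)
    odd+odd = solve-∀

  module Representations {S T : Pred ℕ 0ℓ} (dS : Decidable S) (dT : Decidable T) where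

    Rep : ℕ → ℕ → Set
    Rep a b = (S a × T b) ⊎ (T a × S b)

    rep? : ∀ a b → Dec (Rep a b)
    rep? a b = (dS a ×-dec dT b) ⊎-dec (dT a ×-dec dS b)

    g≡∑ : ¬ S 0 → ¬ T 0 → ∀ y → g dS dT y ≡ ∑ y (λ a → [ (a + a ≤? y) ×-dec rep? a (y ∸ a) ])
    g≡∑ ¬S0 ¬T0 y = gAux≡∑ y
      where
      ¬Rep0 : ∀ {b} → ¬ Rep 0 b
      ¬Rep0 (inj₁ (s , _)) = ¬S0 s
      ¬Rep0 (inj₂ (t , _)) = ¬T0 t

      gAux≡∑ : ∀ m → gAux dS dT y m ≡ ∑ m (λ a → [ (a + a ≤? y) ×-dec rep? a (y ∸ a) ])
      gAux≡∑ zero    = []≡0 ((0 + 0 ≤? y) ×-dec rep? 0 y) (¬Rep0 ∘ proj₂)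
      gAux≡∑ (suc m) = cong ([ (suc m + suc m ≤? y) ×-dec rep? (suc m) (y ∸ suc m) ] +_) (gAux≡∑ m)

    module _ (S-odd : ∀ n → S n → Odd n) (T-odd : ∀ n → T n → Odd n) where

      ¬S0 : ¬ S 0
      ¬S0 = ¬Odd0 ∘ S-odd 0

      ¬T0 : ¬ T 0
      ¬T0 = ¬Odd0 ∘ T-odd 0

      ¬Rep-odd : ∀ {a b} → Rep a b → ¬ Odd (a + b)
      ¬Rep-odd (inj₁ (s , t)) = odd+odd-not-odd (S-odd _ s) (T-odd _ t)
      ¬Rep-odd (inj₂ (t , s)) = odd+odd-not-odd (T-odd _ t) (S-odd _ s)

      g-odd : ∀ k → g dS dT (suc (2 * k)) ≡ 0
      g-odd k =
        trans (g≡∑ ¬S0 ¬T0 y) (∑-zero y λ a _ → []≡0 ((a + a ≤? y) ×-dec rep? a (y ∸ a)) (no-rep a))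
        where
        y = suc (2 * k)
        no-rep : ∀ a → ¬ (a + a ≤ y × Rep a (y ∸ a))
        no-rep a (a+a≤y , r) =
          ¬Rep-odd r (subst Odd (sym (m+[n∸m]≡n (≤-trans (m≤m+n a a) a+a≤y))) (k , refl))

      ∑-g≡gSum : ∀ k → ∑ (2 * k) (g dS dT) ≡ gSum dS dT k
      ∑-g≡gSum k = trans (∑-evens k (g dS dT) g-odd) (sym (gSum≡∑ k))
        where
        gSum≡∑ : ∀ k → gSum dS dT k ≡ ∑ k (λ i → g dS dT (2 * i))
        gSum≡∑ zero    = refl
        gSum≡∑ (suc k) = cong (g dS dT (2 * suc k) +_) (gSum≡∑ k)

      ∑-g≡∑∑ : ∀ x → ∑ x (g dS dT) ≡ ∑∑ x (λ a b → [ a ≤? b ×-dec b ≤? x ∸ a ] * [ rep? a b ])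
      ∑-g≡∑∑ x = begin
          ∑ x (g dS dT)
        ≡⟨ ∑-cong x (λ y _ y≤x → trans (g≡∑ ¬S0 ¬T0 y) (∑-truncate (term y) y≤x)) ⟩
          ∑ x (λ y → ∑ x (λ a → [ a ≤? y ] * term y a))
        ≡⟨ ∑-comm x x (λ y a → [ a ≤? y ] * term y a) ⟩
          ∑ x (λ a → ∑ x (λ y → [ a ≤? y ] * term y a))
        ≡⟨ ∑-cong x column ⟩
          ∑∑ x (λ a b → [ a ≤? b ×-dec b ≤? x ∸ a ] * [ rep? a b ])
        ∎
        where
        term : ℕ → ℕ → ℕ
        term y a = [ (a + a ≤? y) ×-dec rep? a (y ∸ a) ]

        column : ∀ a → 1 ≤ a → a ≤ x →
                 ∑ x (λ y → [ a ≤? y ] * term y a) ≡ ∑ x (λ b → [ a ≤? b ×-dec b ≤? x ∸ a ] * [ rep? a b ])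
        column a 1≤a a≤x = begin
            ∑ x (λ y → [ a ≤? y ] * term y a)
          ≡⟨ ∑-cong x (λ y _ _ → [a≤y]*[a+a≤y]≡[a<y]*[a≤y∸a] (rep? a (y ∸ a)) 1≤a) ⟩
            ∑ x (λ y → [ a <? y ] * H (y ∸ a))
          ≡⟨ cong (λ n → ∑ n (λ y → [ a <? y ] * H (y ∸ a))) (m∸n+n≡m a≤x) ⟨
            ∑ (x ∸ a + a) (λ y → [ a <? y ] * H (y ∸ a))
          ≡⟨ ∑-shift (x ∸ a) a H ⟩
            ∑ (x ∸ a) H
          ≡⟨ ∑-truncate H (m∸n≤m x a) ⟩
            ∑ x (λ b → [ b ≤? x ∸ a ] * H b)
          ≡⟨ ∑-cong x (λ b _ _ → [q]*[p×r]≡[p×q]*[r] (a ≤? b) (b ≤? x ∸ a) (rep? a b)) ⟩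
            ∑ x (λ b → [ a ≤? b ×-dec b ≤? x ∸ a ] * [ rep? a b ])
          ∎
          where
          H : ℕ → ℕ
          H b = [ a ≤? b ×-dec rep? a b ]

      ∑-g≡g+gSum : ∀ {x} h → h + h ≡ x → ∑ x (g dS dT) ≡ g dS dT x + gSum dS dT (h ∸ 1)
      ∑-g≡g+gSum zero    refl = sym (trans (+-identityʳ (g dS dT 0)) (g≡∑ ¬S0 ¬T0 0))
      ∑-g≡g+gSum (suc k) refl = subst (λ n → ∑ n (g dS dT) ≡ g dS dT n + gSum dS dT k)
                                      (cong (suc k +_) (+-identityʳ (suc k))) (∑-g≡gSum (suc k))

  module Decomposition {S T : Pred ℕ 0ℓ} (dS : Decidable S) (dT : Decidable T) {h x : ℕ} (h+h≡x : h + h ≡ x) where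
    open Representations dS dT

    h≤x : h ≤ x
    h≤x = subst (h ≤_) h+h≡x (m≤m+n h h)

    h≤x∸a : ∀ {a} → a ≤ h → h ≤ x ∸ a
    h≤x∸a {a} a≤h = m+n≤o⇒m≤o∸n h (subst (h + a ≤_) h+h≡x (+-monoʳ-≤ h a≤h))

    open RegionSums x

    dW : Decidable (S ∩ T)
    dW = ∩-dec dS dT

    rep : ℕ → ℕ → ℕ
    rep a b = [ rep? a b ]

    strip? : ∀ a b → Dec (a ≤ h × b ≤ x ∸ a)
    strip? a b = a ≤? h ×-dec b ≤? x ∸ a

    ordered? : ∀ a b → Dec (a ≤ b × b ≤ x ∸ a)
    ordered? a b = a ≤? b ×-dec b ≤? x ∸ a

    below? : ∀ a b → Dec (b < a × a ≤ h)
    below? a b = b <? a ×-dec a ≤? h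

    diagonal? : ∀ a b → Dec (b ≡ a × a ≤ h)
    diagonal? a b = b ≟ a ×-dec a ≤? h

    square? : ∀ a b → Dec (a ≤ h × b ≤ h)
    square? a b = a ≤? h ×-dec b ≤? h

    triangle? : ∀ a b → Dec (a ≤ h × b ≤ a)
    triangle? a b = a ≤? h ×-dec b ≤? a

    [strip]≡[ordered]+[below] : ∀ a b → [ strip? a b ] ≡ [ ordered? a b ] + [ below? a b ]
    [strip]≡[ordered]+[below] a b = []-⊎ (strip? a b) (ordered? a b) (below? a b) split merge disjoint
      where
      split : a ≤ h × b ≤ x ∸ a → (a ≤ b × b ≤ x ∸ a) ⊎ (b < a × a ≤ h)
      split (a≤h , b≤x∸a) with a ≤? b
      ... | yes a≤b = inj₁ (a≤b , b≤x∸a)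
      ... | no  a≰b = inj₂ (≰⇒> a≰b , a≤h)

      merge : (a ≤ b × b ≤ x ∸ a) ⊎ (b < a × a ≤ h) → a ≤ h × b ≤ x ∸ a
      merge (inj₁ (a≤b , b≤x∸a)) = m+m≤n+n⇒m≤n a+a≤h+h , b≤x∸a
        where
        b+a≤x : b + a ≤ x
        b+a≤x = m≤o∸n⇒m+n≤o b (≤-trans a≤b (≤-trans b≤x∸a (m∸n≤m x a))) b≤x∸a

        a+a≤h+h : a + a ≤ h + h
        a+a≤h+h = ≤-trans (+-monoˡ-≤ a a≤b) (subst (b + a ≤_) (sym h+h≡x) b+a≤x)
      merge (inj₂ (b<a , a≤h)) = a≤h , ≤-trans (<⇒≤ b<a) (≤-trans a≤h (h≤x∸a a≤h))

      disjoint : a ≤ b × b ≤ x ∸ a → ¬ (b < a × a ≤ h)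
      disjoint (a≤b , _) (b<a , _) = <⇒≱ b<a a≤b

    [square]≡[below]+[above⊎diagonal] :
      ∀ a b → [ square? a b ] ≡ [ below? a b ] + [ below? b a ⊎-dec diagonal? a b ]
    [square]≡[below]+[above⊎diagonal] a b =
      []-⊎ (square? a b) (below? a b) (below? b a ⊎-dec diagonal? a b) split merge disjoint
      where
      split : a ≤ h × b ≤ h → (b < a × a ≤ h) ⊎ ((a < b × b ≤ h) ⊎ (b ≡ a × a ≤ h))
      split (a≤h , b≤h) with <-cmp a b
      ... | tri< a<b _ _ = inj₂ (inj₁ (a<b , b≤h))
      ... | tri≈ _ a≡b _ = inj₂ (inj₂ (sym a≡b , a≤h))
      ... | tri> _ _ b<a = inj₁ (b<a , a≤h)

      merge : (b < a × a ≤ h) ⊎ ((a < b × b ≤ h) ⊎ (b ≡ a × a ≤ h)) → a ≤ h × b ≤ h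
      merge (inj₁ (b<a , a≤h))         = a≤h , ≤-trans (<⇒≤ b<a) a≤h
      merge (inj₂ (inj₁ (a<b , b≤h)))  = ≤-trans (<⇒≤ a<b) b≤h , b≤h
      merge (inj₂ (inj₂ (refl , a≤h))) = a≤h , a≤h

      disjoint : b < a × a ≤ h → ¬ ((a < b × b ≤ h) ⊎ (b ≡ a × a ≤ h))
      disjoint (b<a , _) (inj₁ (a<b , _))  = <-asym b<a a<b
      disjoint (b<a , _) (inj₂ (refl , _)) = <-irrefl refl b<a

    [above⊎diagonal]≡[above]+[diagonal] :
      ∀ a b → [ below? b a ⊎-dec diagonal? a b ] ≡ [ below? b a ] + [ diagonal? a b ]
    [above⊎diagonal]≡[above]+[diagonal] a b =
      []-⊎ (below? b a ⊎-dec diagonal? a b) (below? b a) (diagonal? a b) id id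
           (λ (a<b , _) (b≡a , _) → <-irrefl (sym b≡a) a<b)

    [triangle]≡[below]+[diagonal] : ∀ a b → [ triangle? a b ] ≡ [ below? a b ] + [ diagonal? a b ]
    [triangle]≡[below]+[diagonal] a b = []-⊎ (triangle? a b) (below? a b) (diagonal? a b) split merge disjoint
      where
      split : a ≤ h × b ≤ a → (b < a × a ≤ h) ⊎ (b ≡ a × a ≤ h)
      split (a≤h , b≤a) = Sum.map (_, a≤h) (_, a≤h) (m≤n⇒m<n∨m≡n b≤a)

      merge : (b < a × a ≤ h) ⊎ (b ≡ a × a ≤ h) → a ≤ h × b ≤ a
      merge (inj₁ (b<a , a≤h))  = a≤h , <⇒≤ b<a
      merge (inj₂ (refl , a≤h)) = a≤h , ≤-refl

      disjoint : b < a × a ≤ h → ¬ (b ≡ a × a ≤ h)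
      disjoint (b<a , _) (refl , _) = <-irrefl refl b<a

    rep+W⊗W≡S⊗T+T⊗S : ∀ a b → rep a b + (dW ⊗ dW) a b ≡ (dS ⊗ dT) a b + (dT ⊗ dS) a b
    rep+W⊗W≡S⊗T+T⊗S a b = 𝟙-inclusion-exclusion (does (dS a)) (does (dT b)) (does (dT a)) (does (dS b))

    ⟪S⊗T⟫+⟪T⊗S⟫≡⟪rep⟫+⟪W⊗W⟫ : ∀ {R : ℕ → ℕ → Set} (R? : ∀ a b → Dec (R a b)) →
                              ⟪ R? ∣ dS ⊗ dT ⟫ + ⟪ R? ∣ dT ⊗ dS ⟫ ≡ ⟪ R? ∣ rep ⟫ + ⟪ R? ∣ dW ⊗ dW ⟫
    ⟪S⊗T⟫+⟪T⊗S⟫≡⟪rep⟫+⟪W⊗W⟫ R? =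
      trans (sym (⟪⟫-split-weight R? (λ _ _ → refl)))
            (⟪⟫-split-weight R? (λ a b → sym (rep+W⊗W≡S⊗T+T⊗S a b)))

    ΣT ΣS ΣW : ℕ
    ΣT = sumOver dT (λ t → count dS (x ∸ t)) h
    ΣS = sumOver dS (λ s → count dT (x ∸ s)) h
    ΣW = sumOver dW (λ w → count dW (x ∸ w)) h

    strip-count : ∀ {A B : Pred ℕ 0ℓ} (dA : Decidable A) (dB : Decidable B) →
                  sumOver dA (λ a → count dB (x ∸ a)) h ≡ ⟪ strip? ∣ dA ⊗ dB ⟫
    strip-count dA dB = sumOver-count≡∑∑ dA dB (x ∸_) h≤x (λ a _ → m∸n≤m x a)

    cross-counts : ΣT + ΣS ≡ ⟪ ordered? ∣ rep ⟫ + ⟪ below? ∣ rep ⟫ + ΣW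
    cross-counts = begin
        ΣT + ΣS
      ≡⟨ cong₂ _+_ (strip-count dT dS) (strip-count dS dT) ⟩
        ⟪ strip? ∣ dT ⊗ dS ⟫ + ⟪ strip? ∣ dS ⊗ dT ⟫
      ≡⟨ +-comm ⟪ strip? ∣ dT ⊗ dS ⟫ ⟪ strip? ∣ dS ⊗ dT ⟫ ⟩
        ⟪ strip? ∣ dS ⊗ dT ⟫ + ⟪ strip? ∣ dT ⊗ dS ⟫
      ≡⟨ ⟪S⊗T⟫+⟪T⊗S⟫≡⟪rep⟫+⟪W⊗W⟫ strip? ⟩
        ⟪ strip? ∣ rep ⟫ + ⟪ strip? ∣ dW ⊗ dW ⟫
      ≡⟨ cong₂ _+_ (⟪⟫-split-region strip? ordered? below? [strip]≡[ordered]+[below] rep)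
                   (sym (strip-count dW dW)) ⟩
        ⟪ ordered? ∣ rep ⟫ + ⟪ below? ∣ rep ⟫ + ΣW
      ∎

    square-split :
      ⟪ square? ∣ dS ⊗ dT ⟫ ≡ ⟪ below? ∣ dS ⊗ dT ⟫ + ⟪ below? ∣ dT ⊗ dS ⟫ + ⟪ diagonal? ∣ dW ⊗ dW ⟫
    square-split = begin
        ⟪ square? ∣ dS ⊗ dT ⟫
      ≡⟨ ⟪⟫-split-region square? below? above⊎diagonal? [square]≡[below]+[above⊎diagonal] (dS ⊗ dT) ⟩
        ⟪ below? ∣ dS ⊗ dT ⟫ + ⟪ above⊎diagonal? ∣ dS ⊗ dT ⟫
      ≡⟨ cong (⟪ below? ∣ dS ⊗ dT ⟫ +_)
              (⟪⟫-split-region above⊎diagonal? above? diagonal?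
                               [above⊎diagonal]≡[above]+[diagonal] (dS ⊗ dT)) ⟩
        ⟪ below? ∣ dS ⊗ dT ⟫ + (⟪ above? ∣ dS ⊗ dT ⟫ + ⟪ diagonal? ∣ dS ⊗ dT ⟫)
      ≡⟨ cong₂ (λ u v → ⟪ below? ∣ dS ⊗ dT ⟫ + (u + v)) transpose-above on-diagonal ⟩
        ⟪ below? ∣ dS ⊗ dT ⟫ + (⟪ below? ∣ dT ⊗ dS ⟫ + ⟪ diagonal? ∣ dW ⊗ dW ⟫)
      ≡⟨ +-assoc ⟪ below? ∣ dS ⊗ dT ⟫ ⟪ below? ∣ dT ⊗ dS ⟫ ⟪ diagonal? ∣ dW ⊗ dW ⟫ ⟨
        ⟪ below? ∣ dS ⊗ dT ⟫ + ⟪ below? ∣ dT ⊗ dS ⟫ + ⟪ diagonal? ∣ dW ⊗ dW ⟫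
      ∎
      where
      above? : ∀ a b → Dec (a < b × b ≤ h)
      above? a b = below? b a

      above⊎diagonal? : ∀ a b → Dec ((a < b × b ≤ h) ⊎ (b ≡ a × a ≤ h))
      above⊎diagonal? a b = below? b a ⊎-dec diagonal? a b

      transpose-above : ⟪ above? ∣ dS ⊗ dT ⟫ ≡ ⟪ below? ∣ dT ⊗ dS ⟫
      transpose-above = trans (⟪⟫-transpose below? (dS ⊗ dT))
                              (∑∑-cong x (λ a b → cong ([ below? a b ] *_) (*-comm [ dS b ] [ dT a ])))

      on-diagonal : ⟪ diagonal? ∣ dS ⊗ dT ⟫ ≡ ⟪ diagonal? ∣ dW ⊗ dW ⟫
      on-diagonal = ∑∑-cong x λ a b → []-*-cong (diagonal? a b) λ (b≡a , _) → diagonal-weight b≡a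
        where
        diagonal-weight : ∀ {a b} → b ≡ a → (dS ⊗ dT) a b ≡ (dW ⊗ dW) a b
        diagonal-weight {a} refl = 𝟙-∧-idem (does (dS a)) (does (dT a))

    square-count : count dS h * count dT h ≡ ⟪ below? ∣ rep ⟫ + sumOver dW (count dW) h
    square-count = begin
        count dS h * count dT h
      ≡⟨ count*≡sumOver dS h (count dT h) ⟩
        sumOver dS (λ _ → count dT h) h
      ≡⟨ sumOver-count≡∑∑ dS dT (λ _ → h) h≤x (λ _ _ → h≤x) ⟩
        ⟪ square? ∣ dS ⊗ dT ⟫
      ≡⟨ square-split ⟩
        ⟪ below? ∣ dS ⊗ dT ⟫ + ⟪ below? ∣ dT ⊗ dS ⟫ + ⟪ diagonal? ∣ dW ⊗ dW ⟫
      ≡⟨ cong (_+ ⟪ diagonal? ∣ dW ⊗ dW ⟫) (⟪S⊗T⟫+⟪T⊗S⟫≡⟪rep⟫+⟪W⊗W⟫ below?) ⟩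
        ⟪ below? ∣ rep ⟫ + ⟪ below? ∣ dW ⊗ dW ⟫ + ⟪ diagonal? ∣ dW ⊗ dW ⟫
      ≡⟨ +-assoc ⟪ below? ∣ rep ⟫ ⟪ below? ∣ dW ⊗ dW ⟫ ⟪ diagonal? ∣ dW ⊗ dW ⟫ ⟩
        ⟪ below? ∣ rep ⟫ + (⟪ below? ∣ dW ⊗ dW ⟫ + ⟪ diagonal? ∣ dW ⊗ dW ⟫)
      ≡⟨ cong (⟪ below? ∣ rep ⟫ +_)
              (⟪⟫-split-region triangle? below? diagonal? [triangle]≡[below]+[diagonal] (dW ⊗ dW)) ⟨
        ⟪ below? ∣ rep ⟫ + ⟪ triangle? ∣ dW ⊗ dW ⟫
      ≡⟨ cong (⟪ below? ∣ rep ⟫ +_)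
              (sumOver-count≡∑∑ dW dW (λ a → a) h≤x (λ _ a≤h → ≤-trans a≤h h≤x)) ⟨
        ⟪ below? ∣ rep ⟫ + sumOver dW (count dW) h
      ∎

    module _ (S-odd : ∀ n → S n → Odd n) (T-odd : ∀ n → T n → Odd n) where

      pair-count-identity :
        g dS dT x + gSum dS dT (h ∸ 1) + (ΣW + count dS h * count dT h)
        ≡ ΣT + ΣS + (count dW h + 1) C 2
      pair-count-identity = begin
          g dS dT x + gSum dS dT (h ∸ 1) + (ΣW + count dS h * count dT h)
        ≡⟨ cong (_+ (ΣW + count dS h * count dT h)) (∑-g≡g+gSum S-odd T-odd h h+h≡x) ⟨
          ∑ x (g dS dT) + (ΣW + count dS h * count dT h)
        ≡⟨ cong₂ (λ u v → u + (ΣW + v)) (∑-g≡∑∑ S-odd T-odd x) square-count ⟩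
          ⟪ ordered? ∣ rep ⟫ + (ΣW + (⟪ below? ∣ rep ⟫ + sumOver dW (count dW) h))
        ≡⟨ rearrange ⟪ ordered? ∣ rep ⟫ ΣW ⟪ below? ∣ rep ⟫ (sumOver dW (count dW) h) ⟩
          ⟪ ordered? ∣ rep ⟫ + ⟪ below? ∣ rep ⟫ + ΣW + sumOver dW (count dW) h
        ≡⟨ cong₂ _+_ cross-counts (count-choose-2 dW h) ⟨
          ΣT + ΣS + (count dW h + 1) C 2
        ∎
        where
        rearrange : ∀ o w b c → o + (w + (b + c)) ≡ o + b + w + c
        rearrange = solve-∀

open import Data.Nat using (ℕ; _≤_; _/_; _∸_) renaming (_+_ to _+ℕ_)
open import Data.Nat.Divisibility using (_∣_)
open import Data.Nat.Combinatorics using (_C_)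
open import Data.Integer using (ℤ; +_; _+_; _-_; _*_)
open import Relation.Unary using (Pred; Decidable; _∩_)
open import Relation.Binary.PropositionalEquality using (_≡_)
open import Level using (0ℓ)

open import Data.Nat using () renaming (_*_ to _*ℕ_)
open import Data.Nat.Divisibility using (divides)
open import Data.Nat.DivMod using (m*n/n≡m)
open import Data.Nat.Properties using (*-comm; +-identityʳ)
open import Data.Integer.Properties using (pos-+; pos-*)
open import Data.Integer.Tactic.RingSolver using (solve-∀)
open import Relation.Binary.PropositionalEquality using (refl; sym; trans; cong; cong₂; module ≡-Reasoning)

ℕ-identity⇒ℤ : ∀ g gs w a b t s c → g +ℕ gs +ℕ (w +ℕ a *ℕ b) ≡ t +ℕ s +ℕ c →
               + g ≡ + t + + s - + w - + a * + b + + c - + gs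
ℕ-identity⇒ℤ g gs w a b t s c eq = begin
    + g
  ≡⟨ cancel (+ g) (+ gs) (+ w + + a * + b) ⟩
    + g + + gs + (+ w + + a * + b) - (+ gs + (+ w + + a * + b))
  ≡⟨ cong (_- (+ gs + (+ w + + a * + b))) (trans (sym lhs-cast) (trans (cong +_ eq) rhs-cast)) ⟩
    + t + + s + + c - (+ gs + (+ w + + a * + b))
  ≡⟨ regroup (+ t) (+ s) (+ c) (+ gs) (+ w) (+ a) (+ b) ⟩
    + t + + s - + w - + a * + b + + c - + gs
  ∎
  where
  open ≡-Reasoning

  lhs-cast : + (g +ℕ gs +ℕ (w +ℕ a *ℕ b)) ≡ + g + + gs + (+ w + + a * + b)
  lhs-cast = trans (pos-+ (g +ℕ gs) (w +ℕ a *ℕ b))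
                   (cong₂ _+_ (pos-+ g gs) (trans (pos-+ w (a *ℕ b)) (cong (λ z → + w + z) (pos-* a b))))

  rhs-cast : + (t +ℕ s +ℕ c) ≡ + t + + s + + c
  rhs-cast = trans (pos-+ (t +ℕ s) c) (cong (_+ + c) (pos-+ t s))

  cancel : ∀ (x y z : ℤ) → x ≡ x + y + z - (y + z)
  cancel = solve-∀

  regroup : ∀ (t s c gs w a b : ℤ) → t + s + c - (gs + (w + a * b)) ≡ t + s - w - a * b + c - gs
  regroup = solve-∀

2∣n⇒n/2+n/2≡n : ∀ {n} → 2 ∣ n → n / 2 +ℕ n / 2 ≡ n
2∣n⇒n/2+n/2≡n (divides q refl) =
  trans (cong₂ _+ℕ_ (m*n/n≡m q 2) (m*n/n≡m q 2)) (sym (trans (*-comm q 2) (cong (q +ℕ_) (+-identityʳ q))))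

theorem1 : (S T : Pred ℕ 0ℓ) (dS : Decidable S) (dT : Decidable T) →
    (∀ n → S n → Odd n) → (∀ n → T n → Odd n) →
    (x : ℕ) → 2 ∣ x → 4 ≤ x →
    + g dS dT x ≡
    + sumOver dT (λ t → count dS (x ∸ t)) (x / 2)
    + + sumOver dS (λ s → count dT (x ∸ s)) (x / 2)
    - + sumOver (∩-dec dS dT) (λ w → count (∩-dec dS dT) (x ∸ w)) (x / 2)
    - + count dS (x / 2) * + count dT (x / 2)
    + + ((count (∩-dec dS dT) (x / 2) +ℕ 1) C 2)
    - + gSum dS dT (x / 2 ∸ 1)
theorem1 S T dS dT S-odd T-odd x 2∣x _ =
  ℕ-identity⇒ℤ (g dS dT x) (gSum dS dT (x / 2 ∸ 1)) ΣW (count dS (x / 2)) (count dT (x / 2)) ΣT ΣS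
               ((count (∩-dec dS dT) (x / 2) +ℕ 1) C 2) (pair-count-identity S-odd T-odd)
  where open Counting.Decomposition dS dT {x / 2} (2∣n⇒n/2+n/2≡n 2∣x)
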